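{- If $G$ and $H$ are graphs, then $$\chi_{\times 2}(G\odot H)\in\Big\{\chi_{\times 2}(G),\ \chi_{\times 2}(G)+1,\ \chi_{\times 2}(G)+2,\ \dots,\ \chi_{\times 2}(G)+\Big\lceil \tfrac{|V(H)|}{2}\Big\rceil\Big\}.$$
   Context: All graphs are finite and simple. $N[v]$ is the closed neighborhood of $v$. A $2$-limited packing set is a vertex set $B$ with $|B\cap N[v]|\leq 2$ for all vertices $v$. A $2$-limited packing partition of a graph is a partition of its vertex set into $2$-limited packing sets; $\chi_{\times 2}$ is the minimum number of sets in such a partition. The corona product $G\odot H$, for $V(G)=\{v_1,\dots,v_n\}$, is the graph obtained from one copy of $G$ and $n$ disjoint copies of $H$ by joining $v_i$ to every vertex of the $i$-th copy of $H$, for each $i$. -}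

module Defs where

open import Data.Bool using (Bool; true; false; _∧_; _∨_; if_then_else_)
open import Data.Nat using (ℕ; zero; suc; _+_; _*_; _≤_; _<_)
open import Data.Fin using (Fin; splitAt; remQuot)
open import Data.Fin.Properties using (_≟_)
open import Data.List using (List; allFin; map)
open import Data.Nat.ListAction using (sum)
open import Data.Sum using (_⊎_; inj₁; inj₂)
open import Data.Product using (_×_; _,_; ∃)
open import Relation.Nullary using (¬_)
open import Relation.Nullary.Decidable using (⌊_⌋)
open import Relation.Binary.PropositionalEquality using (_≡_)

record Graph : Set where
  field
    order : ℕ
    adj   : Fin order → Fin order → Bool
open Graph public

record IsSimple (G : Graph) : Set where
  field
    adj-sym    : ∀ u v → adj G u v ≡ adj G v u
    adj-irrefl : ∀ v → adj G v v ≡ false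

card : ∀ {n} → (Fin n → Bool) → ℕ
card {n} P = sum (map (λ u → if P u then 1 else 0) (allFin n))

closedNbhd : (G : Graph) → Fin (order G) → Fin (order G) → Bool
closedNbhd G v u = ⌊ u ≟ v ⌋ ∨ adj G v u

Is2LimitedPacking : (G : Graph) → (Fin (order G) → Bool) → Set
Is2LimitedPacking G B = ∀ v → card (λ u → B u ∧ closedNbhd G v u) ≤ 2

-- a partition of V(G) into (at most) k sets, given by the class map c;
-- class i is { u | c u ≡ i }
Is2LimitedPackingPartition : (G : Graph) (k : ℕ) → (Fin (order G) → Fin k) → Set
Is2LimitedPackingPartition G k c =
  ∀ (i : Fin k) → Is2LimitedPacking G (λ u → ⌊ c u ≟ i ⌋)

HasPartition : Graph → ℕ → Set
HasPartition G k = ∃ λ (c : Fin (order G) → Fin k) → Is2LimitedPackingPartition G k c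

IsChi×2 : Graph → ℕ → Set
IsChi×2 G k = HasPartition G k × (∀ j → j < k → ¬ HasPartition G j)

-- corona product G ⊙ H; vertices Fin (n + n * h): first n are V(G),
-- vertex (i , x) of the i-th copy of H is encoded via remQuot.
_⊙_ : Graph → Graph → Graph
G ⊙ H = record { order = n + n * h ; adj = a }
  where
  n = order G
  h = order H
  a : Fin (n + n * h) → Fin (n + n * h) → Bool
  a x y with splitAt n x | splitAt n y
  ... | inj₁ i | inj₁ j = adj G i j
  ... | inj₁ i | inj₂ q with remQuot {n} h q
  ...   | (j , _) = ⌊ i ≟ j ⌋
  a x y | inj₂ p | inj₁ j with remQuot {n} h p
  ...   | (i , _) = ⌊ i ≟ j ⌋
  a x y | inj₂ p | inj₂ q with remQuot {n} h p | remQuot {n} h q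
  ...   | (i , u) | (j , w) = ⌊ i ≟ j ⌋ ∧ adj H u w

-- Restricting a 2-limited packing partition of G ⊙ H to the base vertices partitions G, because
-- G is an induced subgraph and N_G[v] ⊆ N_{G⊙H}[v]; so χ×2(G) ≤ χ×2(G ⊙ H). Conversely, keep a
-- partition of G on the base vertices and give vertex w of every copy of H the new colour ⌊w/2⌋.
-- A closed neighbourhood meets at most one copy of H (the one attached to its owner), so it
-- contains at most the two vertices 2t and 2t+1 of the new class t, and N[x] of a vertex x in
-- the copy at v meets the old classes only in v.

{-# OPTIONS --safe #-}
module Submission where

open import Defs
open import Data.Nat using (ℕ; _+_; _≤_; ⌈_/2⌉)
open import Data.Product using (_×_; ∃)

open import Data.Bool using (Bool; true; false; T; _∧_; _∨_; not; if_then_else_)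
open import Data.Bool.Properties using (T-≡; T-not-≡; T-∧; T-∨)
open import Data.Fin
  using (Fin; zero; suc; toℕ; fromℕ<; _↑ˡ_; _↑ʳ_; splitAt; combine; remQuot; finToFun; funToFin)
open import Data.Fin.Properties
  using (_≟_; 0≢1+n; suc-injective; any?; all?; toℕ<n; toℕ-fromℕ<; toℕ-injective
        ; splitAt-↑ˡ; splitAt-↑ʳ; splitAt⁻¹-↑ˡ; splitAt⁻¹-↑ʳ; ↑ˡ-injective; ↑ʳ-injective
        ; remQuot-combine; combine-surjective; combine-injectiveˡ; finToFun-funToFin)
open import Data.List using (allFin)
open import Data.List.Properties using (map-tabulate; map-cong)
open import Data.Nat using (zero; suc; pred; _*_; z≤n; _<_; _≤?_; ⌊_/2⌋)
open import Data.Nat.ListAction using (sum)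
open import Data.Nat.Properties
  using (≤-refl; +-mono-≤; m≤m+n; m≤n⇒m≤1+n; ≮⇒≥; m<1+n⇒m<n∨m≡n; +-suc; +-identityʳ; +-assoc
        ; ⌈n/2⌉-mono; module ≤-Reasoning)
open import Data.Product using (_,_; proj₁; proj₂; uncurry)
open import Data.Sum using (_⊎_; inj₁; inj₂; [_,_]′)
open import Function using (_∘_; id; const; _⇔_; mk⇔; Equivalence)
open import Relation.Nullary using (¬_; Dec; yes; no; contradiction)
open import Relation.Nullary.Decidable using (⌊_⌋; map′; toWitness; does-⇔; isYes≗does)
open import Relation.Unary using (Decidable)
open import Relation.Binary.PropositionalEquality
  using (_≡_; _≢_; _≗_; refl; sym; trans; cong; cong₂; subst; module ≡-Reasoning)

open Equivalence using (to; from)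

private
  variable
    a b k : ℕ

card-cong : {P Q : Fin a → Bool} → P ≗ Q → card P ≡ card Q
card-cong {a} P≗Q = cong sum (map-cong (cong (λ b → if b then 1 else 0) ∘ P≗Q) (allFin a))

card-suc : (P : Fin (suc a) → Bool) → card P ≡ (if P zero then 1 else 0) + card (P ∘ suc)
card-suc P = cong ((if P zero then 1 else 0) +_) (cong sum
  (trans (map-tabulate suc (λ u → if P u then 1 else 0))
         (sym (map-tabulate id (λ u → if P (suc u) then 1 else 0)))))

card-++ : (P : Fin (a + b) → Bool) → card P ≡ card (P ∘ (_↑ˡ b)) + card (P ∘ (a ↑ʳ_))
card-++ {zero} P = refl
card-++ {suc a} {b} P rewrite card-suc P | card-suc (P ∘ (_↑ˡ b)) =
  trans (cong ((if P zero then 1 else 0) +_) (card-++ {a} (P ∘ suc)))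
        (sym (+-assoc (if P zero then 1 else 0) _ _))

card-empty : {P : Fin a → Bool} → (∀ u → ¬ T (P u)) → card P ≡ 0
card-empty {zero} ¬P = refl
card-empty {suc a} {P} ¬P with P zero in eq | card-suc P
... | true  | _  = contradiction (from T-≡ eq) (¬P zero)
... | false | eq′ = trans eq′ (card-empty (¬P ∘ suc))

card≤1 : {P : Fin a → Bool} → (∀ u v → T (P u) → T (P v) → u ≡ v) → card P ≤ 1
card≤1 {zero} unique = z≤n
card≤1 {suc a} {P} unique rewrite card-suc P with P zero in eq
... | true  = subst (_≤ 1) (sym (cong suc (card-empty {P = P ∘ suc} λ u pu →
  0≢1+n (unique zero (suc u) (from T-≡ eq) pu)))) ≤-refl
... | false = card≤1 (λ u v pu pv → suc-injective (unique (suc u) (suc v) pu pv))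

card-split : (P E : Fin a → Bool) →
  card P ≡ card (λ u → P u ∧ E u) + card (λ u → P u ∧ not (E u))
card-split {zero} P E = refl
card-split {suc a} P E
  rewrite card-suc P | card-suc (λ u → P u ∧ E u) | card-suc (λ u → P u ∧ not (E u))
  with P zero | E zero | card-split (P ∘ suc) (E ∘ suc)
... | true  | true  | eq = cong suc eq
... | true  | false | eq = trans (cong suc eq) (sym (+-suc _ _))
... | false | _     | eq = eq

card≤2 : {P : Fin a → Bool} (g : Fin a → Bool) →
  (∀ u v → T (P u) → T (P v) → g u ≡ g v → u ≡ v) → card P ≤ 2
card≤2 {P = P} g injective = subst (_≤ 2) (sym (card-split P g))
  (+-mono-≤ (card≤1 (sameSide (to T-≡))) (card≤1 (sameSide (to T-not-≡))))
  where
  sameSide : ∀ {E : Bool → Bool} {b} → (∀ {x} → T (E x) → x ≡ b) →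
    ∀ u v → T (P u ∧ E (g u)) → T (P v ∧ E (g v)) → u ≡ v
  sameSide side u v pu pv with to (T-∧ {P u}) pu | to (T-∧ {P v}) pv
  ... | Pu , Eu | Pv , Ev = injective u v Pu Pv (trans (side Eu) (sym (side Ev)))

isYes-⇔ : {A B : Set} → A ⇔ B → (a? : Dec A) (b? : Dec B) → ⌊ a? ⌋ ≡ ⌊ b? ⌋
isYes-⇔ A⇔B a? b? = trans (isYes≗does a?) (trans (does-⇔ A⇔B a? b?) (sym (isYes≗does b?)))

↑ˡ≢↑ʳ : {i : Fin a} {j : Fin b} → i ↑ˡ b ≢ a ↑ʳ j
↑ˡ≢↑ʳ {a} {b} {i} {j} eq
  with () ← trans (sym (splitAt-↑ˡ a i b)) (trans (cong (splitAt a) eq) (splitAt-↑ʳ a b j))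

isEven : ℕ → Bool
isEven zero          = true
isEven (suc zero)    = false
isEven (suc (suc m)) = isEven m

⌊n/2⌋-isEven-injective : ∀ m n → ⌊ m /2⌋ ≡ ⌊ n /2⌋ → isEven m ≡ isEven n → m ≡ n
⌊n/2⌋-isEven-injective zero          zero          _  _  = refl
⌊n/2⌋-isEven-injective (suc zero)    (suc zero)    _  _  = refl
⌊n/2⌋-isEven-injective (suc (suc m)) (suc (suc n)) eq ev =
  cong (2 +_) (⌊n/2⌋-isEven-injective m n (cong pred eq) ev)
⌊n/2⌋-isEven-injective zero          (suc zero)    _  ()
⌊n/2⌋-isEven-injective (suc zero)    zero          _  ()
⌊n/2⌋-isEven-injective zero          (suc (suc n)) () _
⌊n/2⌋-isEven-injective (suc zero)    (suc (suc n)) () _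
⌊n/2⌋-isEven-injective (suc (suc m)) zero          () _
⌊n/2⌋-isEven-injective (suc (suc m)) (suc zero)    () _

half : Fin a → Fin ⌈ a /2⌉
half w = fromℕ< (⌈n/2⌉-mono (toℕ<n w))

half-injective : {w w′ : Fin a} → half w ≡ half w′ → isEven (toℕ w) ≡ isEven (toℕ w′) →
  w ≡ w′
half-injective {w = w} {w′} eq ev = toℕ-injective (⌊n/2⌋-isEven-injective (toℕ w) (toℕ w′)
  (trans (sym (toℕ-fromℕ< _)) (trans (cong toℕ eq) (toℕ-fromℕ< _))) ev)

least-witness : {Q : ℕ → Set} → Decidable Q → ∀ {N} → Q N →
  ∃ λ k → Q k × (∀ j → j < k → ¬ Q j)
least-witness {Q} Q? {N} qN = [ id , (λ none → contradiction qN (none N ≤-refl)) ]′ (search (suc N))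
  where
  search : ∀ M → (∃ λ k → Q k × (∀ j → j < k → ¬ Q j)) ⊎ (∀ j → j < M → ¬ Q j)
  search zero = inj₂ λ _ ()
  search (suc M) with search M | Q? M
  ... | inj₁ least | _      = inj₁ least
  ... | inj₂ none  | yes qM = inj₁ (M , qM , none)
  ... | inj₂ none  | no ¬qM =
    inj₂ λ j j<1+M → [ none j , (λ { refl → ¬qM }) ]′ (m<1+n⇒m<n∨m≡n j<1+M)

∃-function? : {P : (Fin a → Fin b) → Set} → (∀ {f g} → f ≗ g → P f → P g) →
  (∀ f → Dec (P f)) → Dec (∃ P)
∃-function? resp P? = map′ (λ (i , p) → finToFun i , p)
  (λ (f , p) → funToFin f , resp (sym ∘ finToFun-funToFin f) p)
  (any? (P? ∘ finToFun))

inClassNbhd : ∀ G → (Fin (order G) → Fin k) → Fin k → Fin (order G) → Fin (order G) → Bool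
inClassNbhd G c i v u = ⌊ c u ≟ i ⌋ ∧ closedNbhd G v u

inClassNbhd⁻ : ∀ G (c : Fin (order G) → Fin k) i v u →
  T (inClassNbhd G c i v u) → c u ≡ i × T (closedNbhd G v u)
inClassNbhd⁻ G c i v u p with to (T-∧ {⌊ c u ≟ i ⌋}) p
... | cu≡i , u∈N[v] = toWitness cu≡i , u∈N[v]

isPartition? : ∀ G k c → Dec (Is2LimitedPackingPartition G k c)
isPartition? G k c = all? λ i → all? λ v → card (inClassNbhd G c i v) ≤? 2

isPartition-resp : ∀ G {c d : Fin (order G) → Fin k} → c ≗ d →
  Is2LimitedPackingPartition G k c → Is2LimitedPackingPartition G k d
isPartition-resp G c≗d pc i v =
  subst (_≤ 2) (card-cong λ u → cong (λ j → ⌊ j ≟ i ⌋ ∧ closedNbhd G v u) (c≗d u)) (pc i v)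

hasPartition? : ∀ G k → Dec (HasPartition G k)
hasPartition? G k = ∃-function? (isPartition-resp G) (isPartition? G k)

hasPartition-order : ∀ G → HasPartition G (order G)
hasPartition-order G = id , λ i v → m≤n⇒m≤1+n (card≤1 λ u u′ pu pu′ →
  trans (proj₁ (inClassNbhd⁻ G id i v u pu)) (sym (proj₁ (inClassNbhd⁻ G id i v u′ pu′))))

χ×2-exists : ∀ G → ∃ (IsChi×2 G)
χ×2-exists G = least-witness (hasPartition? G) (hasPartition-order G)

module Corona (G H : Graph) where

  private
    n = order G
    h = order H
    GH = G ⊙ H

  base : Fin n → Fin (order GH)
  base u = u ↑ˡ n * h

  copy : Fin n → Fin h → Fin (order GH)
  copy i w = n ↑ʳ combine i w

  data View : Fin (order GH) → Set where
    in-base : ∀ u → View (base u)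
    in-copy : ∀ i w → View (copy i w)

  view : ∀ x → View x
  view x with splitAt n x in eq
  ... | inj₁ u = subst View (splitAt⁻¹-↑ˡ eq) (in-base u)
  ... | inj₂ q with i , w , refl ← combine-surjective {n} {h} q =
    subst View (splitAt⁻¹-↑ʳ eq) (in-copy i w)

  base≢copy : ∀ {u i w} → base u ≢ copy i w
  base≢copy = ↑ˡ≢↑ʳ

  copy-injectiveˡ : ∀ {i w j w′} → copy i w ≡ copy j w′ → i ≡ j
  copy-injectiveˡ {i} {w} {j} {w′} eq = combine-injectiveˡ i w j w′ (↑ʳ-injective n _ _ eq)

  elim : {A : Set} → (Fin n → A) → (Fin n → Fin h → A) → Fin (order GH) → A
  elim f g x = [ f , uncurry g ∘ remQuot h ]′ (splitAt n x)

  elim-base : ∀ {A : Set} {f : Fin n → A} {g} u → elim f g (base u) ≡ f u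
  elim-base u rewrite splitAt-↑ˡ n u (n * h) = refl

  elim-copy : ∀ {A : Set} {f : Fin n → A} {g} i w → elim f g (copy i w) ≡ g i w
  elim-copy {g = g} i w rewrite splitAt-↑ʳ n (n * h) (combine i w) =
    cong (uncurry g) (remQuot-combine i w)

  owner : Fin (order GH) → Fin n
  owner = elim id const

  owner-base : ∀ u → owner (base u) ≡ u
  owner-base = elim-base {g = const}

  owner-copy : ∀ i w → owner (copy i w) ≡ i
  owner-copy = elim-copy {f = id}

  adj-base-base : ∀ v u → adj GH (base v) (base u) ≡ adj G v u
  adj-base-base v u rewrite splitAt-↑ˡ n v (n * h) | splitAt-↑ˡ n u (n * h) = refl

  adj-base-copy : ∀ v i w → adj GH (base v) (copy i w) ≡ ⌊ v ≟ i ⌋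
  adj-base-copy v i w rewrite splitAt-↑ˡ n v (n * h) | splitAt-↑ʳ n (n * h) (combine i w) =
    cong (λ r → ⌊ v ≟ proj₁ r ⌋) (remQuot-combine i w)

  adj-copy-base : ∀ i w u → adj GH (copy i w) (base u) ≡ ⌊ i ≟ u ⌋
  adj-copy-base i w u rewrite splitAt-↑ʳ n (n * h) (combine i w) | splitAt-↑ˡ n u (n * h) =
    cong (λ r → ⌊ proj₁ r ≟ u ⌋) (remQuot-combine i w)

  adj-copy-copy : ∀ i w j w′ → adj GH (copy i w) (copy j w′) ≡ ⌊ i ≟ j ⌋ ∧ adj H w w′
  adj-copy-copy i w j w′
    rewrite splitAt-↑ʳ n (n * h) (combine i w) | splitAt-↑ʳ n (n * h) (combine j w′) =
    cong₂ (λ r r′ → ⌊ proj₁ r ≟ proj₁ r′ ⌋ ∧ adj H (proj₂ r) (proj₂ r′))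
      (remQuot-combine i w) (remQuot-combine j w′)

  closedNbhd-base-base : ∀ v u → closedNbhd GH (base v) (base u) ≡ closedNbhd G v u
  closedNbhd-base-base v u =
    cong₂ _∨_ (isYes-⇔ (mk⇔ (↑ˡ-injective (n * h) u v) (cong base)) (base u ≟ base v) (u ≟ v))
              (adj-base-base v u)

  closedNbhd-copy-base⁻ : ∀ i w u → T (closedNbhd GH (copy i w) (base u)) → i ≡ u
  closedNbhd-copy-base⁻ i w u p with to (T-∨ {⌊ base u ≟ copy i w ⌋}) p
  ... | inj₁ u≡copy = contradiction (toWitness u≡copy) base≢copy
  ... | inj₂ adjacent = toWitness (subst T (adj-copy-base i w u) adjacent)

  closedNbhd-copy⁻ : ∀ y i w → T (closedNbhd GH y (copy i w)) → owner y ≡ i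
  closedNbhd-copy⁻ y i w p with view y | to (T-∨ {⌊ copy i w ≟ y ⌋}) p
  ... | in-base v | inj₁ copy≡v = contradiction (sym (toWitness copy≡v)) base≢copy
  ... | in-base v | inj₂ adjacent =
    trans (owner-base v) (toWitness (subst T (adj-base-copy v i w) adjacent))
  ... | in-copy v w₀ | inj₁ copy≡copy =
    trans (owner-copy v w₀) (sym (copy-injectiveˡ (toWitness copy≡copy)))
  ... | in-copy v w₀ | inj₂ adjacent = trans (owner-copy v w₀)
    (toWitness (proj₁ (to (T-∧ {⌊ v ≟ i ⌋}) (subst T (adj-copy-copy v w₀ i w) adjacent))))

  card-base≤card : (P : Fin (order GH) → Bool) → card (P ∘ base) ≤ card P
  card-base≤card P = subst (card (P ∘ base) ≤_) (sym (card-++ {n} P)) (m≤m+n _ _)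

  card≡card-base : {P : Fin (order GH) → Bool} → (∀ i w → ¬ T (P (copy i w))) →
    card P ≡ card (P ∘ base)
  card≡card-base {P} ¬copy = begin
    card P                                        ≡⟨ card-++ {n} P ⟩
    card (P ∘ base) + card (λ q → P (n ↑ʳ q))     ≡⟨ cong (card (P ∘ base) +_) (card-empty ¬P) ⟩
    card (P ∘ base) + 0                           ≡⟨ +-identityʳ _ ⟩
    card (P ∘ base)                               ∎
    where
    open ≡-Reasoning
    ¬P : ∀ q → ¬ T (P (n ↑ʳ q))
    ¬P q with i , w , refl ← combine-surjective {n} {h} q = ¬copy i w

  restrict-isPartition : ∀ {c : Fin (order GH) → Fin k} →
    Is2LimitedPackingPartition GH k c → Is2LimitedPackingPartition G k (c ∘ base)
  restrict-isPartition {c = c} pc i v = begin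
    card (inClassNbhd G (c ∘ base) i v)
      ≡⟨ card-cong (cong (⌊ c (base _) ≟ i ⌋ ∧_) ∘ sym ∘ closedNbhd-base-base v) ⟩
    card (inClassNbhd GH c i (base v) ∘ base)  ≤⟨ card-base≤card _ ⟩
    card (inClassNbhd GH c i (base v))         ≤⟨ pc i (base v) ⟩
    2                                          ∎
    where open ≤-Reasoning

  lift : (Fin n → Fin k) → Fin (order GH) → Fin (k + ⌈ h /2⌉)
  lift {k} c = elim (λ u → c u ↑ˡ ⌈ h /2⌉) (λ _ w → k ↑ʳ half w)

  module _ {k} (c : Fin n → Fin k) where

    lift-base : ∀ u → lift c (base u) ≡ c u ↑ˡ ⌈ h /2⌉
    lift-base = elim-base {g = λ _ w → k ↑ʳ half w}

    lift-copy : ∀ i w → lift c (copy i w) ≡ k ↑ʳ half w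
    lift-copy = elim-copy {f = λ u → c u ↑ˡ ⌈ h /2⌉}

    IsPackingClass : Fin (k + ⌈ h /2⌉) → Set
    IsPackingClass j = Is2LimitedPacking GH (λ x → ⌊ lift c x ≟ j ⌋)

    lift-oldClass : Is2LimitedPackingPartition G k c → ∀ j → IsPackingClass (j ↑ˡ ⌈ h /2⌉)
    lift-oldClass pc j y with view y
    ... | in-base v = begin
      card (inClassNbhd GH (lift c) j′ (base v))         ≡⟨ card≡card-base notCopy ⟩
      card (inClassNbhd GH (lift c) j′ (base v) ∘ base)
        ≡⟨ card-cong (λ u → cong₂ _∧_ (inClass-base u) (closedNbhd-base-base v u)) ⟩
      card (inClassNbhd G c j v)                          ≤⟨ pc j v ⟩
      2                                                   ∎
      where
      open ≤-Reasoning
      j′ = j ↑ˡ ⌈ h /2⌉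
      notCopy : ∀ i w → ¬ T (inClassNbhd GH (lift c) j′ (base v) (copy i w))
      notCopy i w p = ↑ˡ≢↑ʳ (sym (trans (sym (lift-copy i w))
        (proj₁ (inClassNbhd⁻ GH (lift c) j′ (base v) (copy i w) p))))
      inClass-base : ∀ u → ⌊ lift c (base u) ≟ j′ ⌋ ≡ ⌊ c u ≟ j ⌋
      inClass-base u = isYes-⇔ (mk⇔ (↑ˡ-injective ⌈ h /2⌉ _ _ ∘ trans (sym (lift-base u)))
                                   (trans (lift-base u) ∘ cong (_↑ˡ ⌈ h /2⌉))) _ _
    ... | in-copy v w₀ =
      m≤n⇒m≤1+n (card≤1 λ x x′ px px′ → trans (≡base-v x px) (sym (≡base-v x′ px′)))
      where
      ≡base-v : ∀ x → T (inClassNbhd GH (lift c) (j ↑ˡ ⌈ h /2⌉) (copy v w₀) x) → x ≡ base v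
      ≡base-v x px with view x | inClassNbhd⁻ GH (lift c) (j ↑ˡ ⌈ h /2⌉) (copy v w₀) x px
      ... | in-base u   | _ , u∈N = cong base (sym (closedNbhd-copy-base⁻ v w₀ u u∈N))
      ... | in-copy i w | inClass , _ =
        contradiction (trans (sym (lift-copy i w)) inClass) (↑ˡ≢↑ʳ ∘ sym)

    lift-newClass : ∀ t → IsPackingClass (k ↑ʳ t)
    lift-newClass t y = card≤2 parity sameParity⇒equal
      where
      parity : Fin (order GH) → Bool
      parity = elim (const true) (λ _ w → isEven (toℕ w))
      member : ∀ x → T (inClassNbhd GH (lift c) (k ↑ʳ t) y x) →
        ∃ λ w → x ≡ copy (owner y) w × half w ≡ t
      member x px with view x | inClassNbhd⁻ GH (lift c) (k ↑ʳ t) y x px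
      ... | in-base u   | inClass , _ = contradiction (trans (sym (lift-base u)) inClass) ↑ˡ≢↑ʳ
      ... | in-copy i w | inClass , x∈N =
        w , cong (λ i → copy i w) (sym (closedNbhd-copy⁻ y i w x∈N)) ,
        ↑ʳ-injective k _ _ (trans (sym (lift-copy i w)) inClass)
      sameParity⇒equal : ∀ x x′ → T (inClassNbhd GH (lift c) (k ↑ʳ t) y x) →
        T (inClassNbhd GH (lift c) (k ↑ʳ t) y x′) → parity x ≡ parity x′ → x ≡ x′
      sameParity⇒equal x x′ px px′ same with member x px | member x′ px′
      ... | w , refl , refl | w′ , refl , half≡ = cong (copy (owner y)) (half-injective (sym half≡)
        (trans (sym (elim-copy (owner y) w)) (trans same (elim-copy (owner y) w′))))

    lift-isPartition : Is2LimitedPackingPartition G k c →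
      Is2LimitedPackingPartition GH (k + ⌈ h /2⌉) (lift c)
    lift-isPartition pc j with splitAt k j in eq
    ... | inj₁ j₀ = subst IsPackingClass (splitAt⁻¹-↑ˡ eq) (lift-oldClass pc j₀)
    ... | inj₂ t  = subst IsPackingClass (splitAt⁻¹-↑ʳ eq) (lift-newClass t)

  hasPartition-restrict : HasPartition GH k → HasPartition G k
  hasPartition-restrict (c , pc) = c ∘ base , restrict-isPartition pc

  hasPartition-lift : HasPartition G k → HasPartition GH (k + ⌈ h /2⌉)
  hasPartition-lift (c , pc) = lift c , lift-isPartition c pc

mainTheorem17 : (G H : Graph) → IsSimple G → IsSimple H →
    (∃ λ k → IsChi×2 G k) × (∃ λ m → IsChi×2 (G ⊙ H) m) ×
    (∀ k m → IsChi×2 G k → IsChi×2 (G ⊙ H) m →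
      k ≤ m × m ≤ k + ⌈ order H /2⌉)
mainTheorem17 G H _ _ = χ×2-exists G , χ×2-exists (G ⊙ H) , bounds
  where
  open Corona G H
  bounds : ∀ k m → IsChi×2 G k → IsChi×2 (G ⊙ H) m → k ≤ m × m ≤ k + ⌈ order H /2⌉
  bounds k m (hasG , minimalG) (hasGH , minimalGH) =
    ≮⇒≥ (λ m<k → minimalG m m<k (hasPartition-restrict hasGH)) ,
    ≮⇒≥ (λ k+⌈h/2⌉<m → minimalGH _ k+⌈h/2⌉<m (hasPartition-lift hasG))
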